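{- Let $F=\{f_1,\dots,f_m\}$ be a set of homogeneous polynomials in $\mathbb{Z}[x_1,\dots,x_k]$, let $a_1,\dots,a_k\in\mathbb{Z}$ and $n\ge 1$. For $b\in\mathbb{Z}$ let $g_k(b,n)$ denote the number of $(x_1,\dots,x_k)\in\mathbb{Z}_n^k$ with $a_1x_1+\dots+a_kx_k\equiv b\pmod n$ and $\gcd(f_i(x_1,\dots,x_k),n)=1$ for each $1\le i\le m$. Then $g_k(b,n)=g_k(\gcd(b,n),n)$ for every $b\in\mathbb{Z}$. -}

module Defs where

open import Data.Nat as ℕ using (ℕ; zero; suc; _≥_)
open import Data.Nat.Divisibility using (_∣?_)
open import Data.Integer as ℤ using (ℤ; +_; _*_; _-_; _+_; ∣_∣)
open import Data.Integer.GCD using (gcd)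
open import Data.Integer.Divisibility using (_∣_)
open import Data.Fin using (Fin; toℕ)
open import Data.Fin.Base using ()
open import Data.List as List using (List; []; _∷_; [_]; length; filter; concatMap; map; allFin)
open import Data.List.Relation.Unary.All as ListAll using ()
open import Data.Vec as Vec using (Vec; []; _∷_; zipWith)
open import Data.Vec.Relation.Unary.All as VecAll using ()
open import Data.Product using (_×_; ∃)
open import Relation.Nullary using (Dec; ¬_)
open import Relation.Nullary.Decidable using (_×-dec_)
open import Relation.Binary.PropositionalEquality using (_≡_)

record Term (k : ℕ) : Set where
  constructor term
  field
    coeff : ℤ
    exps  : Vec ℕ k
open Term public

-- A polynomial in ℤ[x₁,…,x_k], as a finite formal sum of terms.
Poly : ℕ → Set
Poly k = List (Term k)

monomial : ∀ {k} → Vec ℕ k → Vec ℤ k → ℤ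
monomial []       []       = + 1
monomial (e ∷ es) (x ∷ xs) = (x ℤ.^ e) * monomial es xs

evalTerm : ∀ {k} → Term k → Vec ℤ k → ℤ
evalTerm t xs = coeff t * monomial (exps t) xs

eval : ∀ {k} → Poly k → Vec ℤ k → ℤ
eval []       xs = + 0
eval (t ∷ ts) xs = evalTerm t xs + eval ts xs

degree : ∀ {k} → Term k → ℕ
degree t = Vec.sum (exps t)

Homogeneous : ∀ {k} → Poly k → Set
Homogeneous f = ∃ λ d → ListAll.All (λ t → ¬ (coeff t ≡ + 0) → degree t ≡ d) f

-- All elements of (ℤ_n)^k, ℤ_n represented by Fin n (residues 0,…,n-1).
allVecs : ∀ k n → List (Vec (Fin n) k)
allVecs zero    n = [ [] ]
allVecs (suc k) n = concatMap (λ i → map (i ∷_) (allVecs k n)) (allFin n)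

lift : ∀ {k n} → Vec (Fin n) k → Vec ℤ k
lift = Vec.map (λ i → + toℕ i)

linForm : ∀ {k} → Vec ℤ k → Vec ℤ k → ℤ
linForm as xs = Vec.foldr _ _+_ (+ 0) (zipWith _*_ as xs)

_≡_[mod_] : ℤ → ℤ → ℕ → Set
u ≡ v [mod n ] = (+ n) ∣ (u - v)

_≡?_[mod_] : ∀ u v n → Dec (u ≡ v [mod n ])
u ≡? v [mod n ] = n ∣? ∣ u - v ∣

Good : ∀ {k m} (F : Vec (Poly k) m) (a : Vec ℤ k) (b : ℤ) (n : ℕ) → Vec (Fin n) k → Set
Good F a b n x = (linForm a (lift x) ≡ b [mod n ])
               × VecAll.All (λ f → gcd (eval f (lift x)) (+ n) ≡ + 1) F

good? : ∀ {k m} (F : Vec (Poly k) m) (a : Vec ℤ k) (b : ℤ) (n : ℕ) → (x : Vec (Fin n) k) → Dec (Good F a b n x)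
good? F a b n x = (linForm a (lift x) ≡? b [mod n ])
           ×-dec VecAll.all? (λ f → gcd (eval f (lift x)) (+ n) ℤ.≟ + 1) F

g : ∀ {k m} (F : Vec (Poly k) m) (a : Vec ℤ k) (b : ℤ) (n : ℕ) → ℕ
g F a b n = length (filter (good? F a b n) (allVecs _ n))

{-# OPTIONS --safe #-}
module Submission where

-- Let d = gcd(b, n). Since b / d is a unit modulo n / d, it lifts (one prime factor of d at a time)
-- to a unit s modulo n, so that b ≡ s d (mod n). Multiplication by s permutes (ℤ_n)^k, turns
-- a·x into s (a·x), and turns f_i(x) into s^(deg f_i) f_i(x), which has the same gcd with n as
-- f_i(x) because s^(deg f_i) is again a unit. So x ↦ s x maps the points counted by g_k(d, n)
-- bijectively onto those counted by g_k(b, n).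

open import Defs
open import Level using (0ℓ)
open import Function using (_∘_)
open import Data.Bool using (true; false)
open import Data.Product using (_×_; _,_; proj₁; proj₂; ∃; ∃₂)
open import Data.Sum using (inj₁; inj₂)
open import Data.Nat as ℕ using (ℕ; zero; suc; _≥_; _<_; NonZero)
open import Data.Nat.ListAction using (sum; product)
import Data.Nat.Properties as ℕ
import Data.Nat.Divisibility as ℕ
import Data.Nat.GCD as ℕ
open import Data.Nat.GCD using (module Bézout)
open import Data.Nat.Coprimality using (Coprime; coprime-Bézout)
open import Data.Integer using (ℤ; +_; -[1+_])
open import Data.Integer.Properties
  using (pos-+; pos-*; +-injective; +-inverseʳ; *-zeroˡ; *-zeroʳ; *-identityˡ; *-assoc; *-comm;
         *-distribˡ-+; neg-distribˡ-*; ^-distribˡ-+-*; ^-zeroˡ; [+m]-[+n]≡m⊖n; ∣m⊝n∣≤m⊔n;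
         ∣i∣≡0⇒i≡0; i-j≡0⇒i≡j)
open import Data.Integer.DivMod using (_%ℕ_; _/ℕ_; n%ℕd<d; a≡a%ℕn+[a/ℕn]*n)
open import Data.Integer.Divisibility using (_∣_)
open import Data.Integer.Divisibility.Signed as Signed
  using (divides; ∣ᵤ⇒∣; ∣⇒∣ᵤ; ∣m∣n⇒∣m+n; ∣m⇒∣-m; ∣m⇒∣m*n; ∣n⇒∣m*n; ∣m∣n⇒∣m-n)
open import Data.Integer.GCD using (gcd; gcd[i,j]∣i; gcd[i,j]∣j; gcd-greatest)
import Data.Integer.Tactic.RingSolver as ℤ-Ring
open import Data.Fin as Fin using (Fin; toℕ; fromℕ<)
open import Data.Fin.Properties using (toℕ-fromℕ<; toℕ-injective; toℕ<n)
open import Data.Fin.Permutation using (Permutation′; permutation; _⟨$⟩ʳ_)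
open import Data.List
  using (List; []; _∷_; _++_; map; filter; length; concatMap; allFin; tabulate)
open import Data.List.Properties using (filter-++; length-++; map-cong; map-tabulate; filter-≐)
open import Data.List.Relation.Unary.All as ListAll using ([]; _∷_)
open import Data.Vec as Vec using (Vec; []; _∷_)
open import Data.Vec.Relation.Unary.All as VecAll using (All)
open import Data.Vec.Relation.Binary.Pointwise.Inductive using (Pointwise; []; _∷_)
import Algebra.Properties.CommutativeMonoid.Sum ℕ.+-0-commutativeMonoid as Σ
open import Relation.Nullary using (¬_; yes; no; does; contradiction)
open import Relation.Unary using (Pred; Decidable; _≐_; _⊆_)
open import Relation.Binary using (Reflexive; Symmetric; Transitive; IsEquivalence; Setoid)
import Relation.Binary.Reasoning.Setoid as ≈-Reasoning
open import Relation.Binary.PropositionalEquality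
  using (_≡_; refl; sym; trans; cong; cong₂; subst; subst₂; module ≡-Reasoning)

-- Counting points of (ℤ_n)^k

module _ {a b p} {A : Set a} {B : Set b} {P : Pred B p} (P? : Decidable P) where

  length-filter-map : ∀ (f : A → B) xs → length (filter P? (map f xs)) ≡ length (filter (P? ∘ f) xs)
  length-filter-map f []       = refl
  length-filter-map f (x ∷ xs) with does (P? (f x))
  ... | true  = cong suc (length-filter-map f xs)
  ... | false = length-filter-map f xs

  length-filter-concatMap : ∀ (f : A → List B) xs →
                            length (filter P? (concatMap f xs)) ≡ sum (map (length ∘ filter P? ∘ f) xs)
  length-filter-concatMap f []       = refl
  length-filter-concatMap f (x ∷ xs) = begin
    length (filter P? (f x ++ concatMap f xs))
      ≡⟨ cong length (filter-++ P? (f x) _) ⟩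
    length (filter P? (f x) ++ filter P? (concatMap f xs))
      ≡⟨ length-++ (filter P? (f x)) ⟩
    length (filter P? (f x)) ℕ.+ length (filter P? (concatMap f xs))
      ≡⟨ cong (_ ℕ.+_) (length-filter-concatMap f xs) ⟩
    length (filter P? (f x)) ℕ.+ sum (map (length ∘ filter P? ∘ f) xs)
      ∎
    where open ≡-Reasoning

sum-tabulate : ∀ {n} (h : Fin n → ℕ) → sum (tabulate h) ≡ Σ.sum h
sum-tabulate {zero}  h = refl
sum-tabulate {suc n} h = cong (h Fin.zero ℕ.+_) (sum-tabulate (h ∘ Fin.suc))

sum-map-allFin-permute : ∀ {n} (π : Permutation′ n) (h : Fin n → ℕ) →
                         sum (map h (allFin n)) ≡ sum (map (h ∘ (π ⟨$⟩ʳ_)) (allFin n))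
sum-map-allFin-permute π h = begin
  sum (map h (allFin _))                ≡⟨ cong sum (map-tabulate (λ i → i) h) ⟩
  sum (tabulate h)                      ≡⟨ sum-tabulate h ⟩
  Σ.sum h                               ≡⟨ Σ.sum-permute h π ⟩
  Σ.sum (h ∘ (π ⟨$⟩ʳ_))                 ≡⟨ sum-tabulate (h ∘ (π ⟨$⟩ʳ_)) ⟨
  sum (tabulate (h ∘ (π ⟨$⟩ʳ_)))        ≡⟨ cong sum (map-tabulate (λ i → i) (h ∘ (π ⟨$⟩ʳ_))) ⟨
  sum (map (h ∘ (π ⟨$⟩ʳ_)) (allFin _)) ∎
  where open ≡-Reasoning

length-filter-allVecs-suc : ∀ {n k p} {P : Pred (Vec (Fin n) (suc k)) p} (P? : Decidable P) →
                            length (filter P? (allVecs (suc k) n))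
                              ≡ sum (map (λ i → length (filter (P? ∘ (i ∷_)) (allVecs k n))) (allFin n))
length-filter-allVecs-suc {n} {k} P? = trans
  (length-filter-concatMap P? (λ i → map (i ∷_) (allVecs k n)) (allFin n))
  (cong sum (map-cong (λ i → length-filter-map P? (i ∷_) (allVecs k n)) (allFin n)))

length-filter-allVecs-permute : ∀ {n} (π : Permutation′ n) k {p} {P : Pred (Vec (Fin n) k) p}
                                (P? : Decidable P) →
                                length (filter P? (allVecs k n))
                                  ≡ length (filter (P? ∘ Vec.map (π ⟨$⟩ʳ_)) (allVecs k n))
length-filter-allVecs-permute π zero    P? = length-filter-map P? (Vec.map (π ⟨$⟩ʳ_)) (allVecs zero _)
length-filter-allVecs-permute {n} π (suc k) P? = begin
  length (filter P? (allVecs (suc k) n))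
    ≡⟨ length-filter-allVecs-suc P? ⟩
  sum (map count (allFin n))
    ≡⟨ sum-map-allFin-permute π count ⟩
  sum (map (count ∘ σ) (allFin n))
    ≡⟨ cong sum (map-cong count-σ (allFin n)) ⟩
  sum (map (λ i → length (filter (P? ∘ Vec.map σ ∘ (i ∷_)) (allVecs k n))) (allFin n))
    ≡⟨ length-filter-allVecs-suc (P? ∘ Vec.map σ) ⟨
  length (filter (P? ∘ Vec.map σ) (allVecs (suc k) n))
    ∎
  where
  open ≡-Reasoning
  σ : Fin n → Fin n
  σ = π ⟨$⟩ʳ_
  count : Fin n → ℕ
  count i = length (filter (P? ∘ (i ∷_)) (allVecs k n))
  count-σ : ∀ i → count (σ i) ≡ length (filter (P? ∘ Vec.map σ ∘ (i ∷_)) (allVecs k n))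
  count-σ i = length-filter-allVecs-permute π k (P? ∘ (σ i ∷_))

-- Lifting units along a divisor of the modulus

module _ where
  open import Data.Nat using (_+_; _*_)
  open import Data.Nat.DivMod using (_/_; m/n*n≡m)
  open import Data.Nat.Divisibility using (_∣?_; _∤_; ∣-trans; ∣m+n∣m⇒∣n)
  open import Data.Nat.Coprimality using (coprime-divisor; coprime-+; coprime-/gcd)
  open import Data.Nat.Primality using (Prime; prime⇒irreducible; ¬prime[1])
  open import Data.Nat.Primality.Factorisation using (factorise; PrimeFactorisation)
  open import Data.Nat.Tactic.RingSolver using (solve-∀)

  coprime-* : ∀ {a m n} → Coprime a m → Coprime a n → Coprime a (m * n)
  coprime-* {m = m} a⊥m a⊥n {d} (d∣a , d∣mn) = a⊥n (d∣a , coprime-divisor d⊥m d∣mn)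
    where
    d⊥m : Coprime d m
    d⊥m (e∣d , e∣m) = a⊥m (∣-trans e∣d d∣a , e∣m)

  prime∤⇒coprime : ∀ {p t} → Prime p → p ∤ t → Coprime t p
  prime∤⇒coprime p-prime p∤t (d∣t , d∣p) with prime⇒irreducible p-prime d∣p
  ... | inj₁ d≡1  = d≡1
  ... | inj₂ refl = contradiction d∣t p∤t

  coprime-lift-prime : ∀ {p u m} → Prime p → Coprime u m → ∃ λ j → Coprime (u + j * m) (m * p)
  coprime-lift-prime {p} {u} {m} p-prime u⊥m with p ∣? u
  ... | no p∤u  = 0 , subst (λ v → Coprime v (m * p)) (sym (ℕ.+-identityʳ u))
                            (coprime-* u⊥m (prime∤⇒coprime p-prime p∤u))
  ... | yes p∣u = 1 , subst (λ v → Coprime (u + v) (m * p)) (sym (ℕ.*-identityˡ m))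
                            (coprime-* u+m⊥m (prime∤⇒coprime p-prime p∤u+m))
    where
    u+m⊥m : Coprime (u + m) m
    u+m⊥m = subst (λ v → Coprime v m) (ℕ.+-comm m u) (coprime-+ u⊥m)
    p∤u+m : p ∤ u + m
    p∤u+m p∣u+m = ¬prime[1] (subst Prime (u⊥m (p∣u , ∣m+n∣m⇒∣n p∣u+m p∣u)) p-prime)

  coprime-lift-primes : ∀ {ps u m} → ListAll.All Prime ps → Coprime u m →
                        ∃ λ j → Coprime (u + j * m) (m * product ps)
  coprime-lift-primes {[]}     {u} {m} []                   u⊥m =
    0 , subst₂ Coprime (sym (ℕ.+-identityʳ u)) (sym (ℕ.*-identityʳ m)) u⊥m
  coprime-lift-primes {p ∷ ps} {u} {m} (p-prime ∷ ps-prime) u⊥m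
    with j₁ , ⊥mp   ← coprime-lift-prime p-prime u⊥m
    with j₂ , ⊥mpps ← coprime-lift-primes ps-prime ⊥mp
    = j₁ + j₂ * p , subst₂ Coprime (regroup u j₁ j₂ p m) (ℕ.*-assoc m p (product ps)) ⊥mpps
    where
    regroup : ∀ u j₁ j₂ p m → u + j₁ * m + j₂ * (m * p) ≡ u + (j₁ + j₂ * p) * m
    regroup = solve-∀

  coprime-lift : ∀ {u m} N .{{_ : NonZero N}} → Coprime u m → ∃ λ j → Coprime (u + j * m) (m * N)
  coprime-lift {u} {m} N u⊥m = subst (λ N → ∃ λ j → Coprime (u + j * m) (m * N)) (sym isFactorisation)
                                     (coprime-lift-primes factorsPrime u⊥m)
    where open PrimeFactorisation (factorise N)

  -- u = B / d is a unit modulo n′ = n / d and B = u d; a unit t ≡ u (mod n′) then has t d ≡ B (mod n).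
  unit-multiple-of-gcd : ∀ B n .{{_ : NonZero n}} → ∃₂ λ t j → Coprime t n × t * ℕ.gcd B n ≡ B + j * n
  unit-multiple-of-gcd B n = u + j * n′ , j , subst (Coprime (u + j * n′)) n′*d≡n t⊥n′*d , t*d≡B+j*n
    where
    d : ℕ
    d = ℕ.gcd B n
    instance
      d≢0 : NonZero d
      d≢0 = ℕ.≢-nonZero (ℕ.gcd[m,n]≢0 B n (inj₂ (ℕ.≢-nonZero⁻¹ n)))
    u n′ : ℕ
    u = B / d
    n′ = n / d
    n′*d≡n : n′ * d ≡ n
    n′*d≡n = m/n*n≡m (ℕ.gcd[m,n]∣n B n)
    u*d≡B : u * d ≡ B
    u*d≡B = m/n*n≡m (ℕ.gcd[m,n]∣m B n)
    j : ℕ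
    j = proj₁ (coprime-lift d (coprime-/gcd B n))
    t⊥n′*d : Coprime (u + j * n′) (n′ * d)
    t⊥n′*d = proj₂ (coprime-lift d (coprime-/gcd B n))
    t*d≡B+j*n : (u + j * n′) * d ≡ B + j * n
    t*d≡B+j*n = begin
      (u + j * n′) * d     ≡⟨ distribute u j n′ d ⟩
      u * d + j * (n′ * d) ≡⟨ cong₂ (λ x y → x + j * y) u*d≡B n′*d≡n ⟩
      B + j * n            ∎
      where
      open ≡-Reasoning
      distribute : ∀ u j n′ d → (u + j * n′) * d ≡ u * d + j * (n′ * d)
      distribute = solve-∀

open import Data.Integer as ℤ using (_+_; _-_; -_; _*_; _^_; ∣_∣)

-- Homogeneity

^-distrib-* : ∀ x y e → (x * y) ^ e ≡ x ^ e * y ^ e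
^-distrib-* x y zero    = refl
^-distrib-* x y (suc e) = trans (cong (x * y *_) (^-distrib-* x y e)) (interchange x y (x ^ e) (y ^ e))
  where
  interchange : ∀ a b c d → a * b * (c * d) ≡ a * c * (b * d)
  interchange = ℤ-Ring.solve-∀

monomial-scale : ∀ s {k} (es : Vec ℕ k) xs →
                 monomial es (Vec.map (s *_) xs) ≡ s ^ Vec.sum es * monomial es xs
monomial-scale s []       []       = sym (*-identityˡ (+ 1))
monomial-scale s (e ∷ es) (x ∷ xs) = begin
  (s * x) ^ e * monomial es (Vec.map (s *_) xs) ≡⟨ cong₂ _*_ (^-distrib-* s x e) (monomial-scale s es xs) ⟩
  s ^ e * x ^ e * (s ^ Vec.sum es * M)         ≡⟨ interchange (s ^ e) (x ^ e) (s ^ Vec.sum es) M ⟩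
  s ^ e * s ^ Vec.sum es * (x ^ e * M)         ≡⟨ cong (_* (x ^ e * M)) (^-distribˡ-+-* s e (Vec.sum es)) ⟨
  s ^ (e ℕ.+ Vec.sum es) * (x ^ e * M)         ∎
  where
  open ≡-Reasoning
  M : ℤ
  M = monomial es xs
  interchange : ∀ a b c d → a * b * (c * d) ≡ a * c * (b * d)
  interchange = ℤ-Ring.solve-∀

-- Terms with coefficient 0 are exempt from the degree condition of Homogeneous.
evalTerm-scale : ∀ s {k D} (t : Term k) → (¬ coeff t ≡ + 0 → degree t ≡ D) → ∀ xs →
                 evalTerm t (Vec.map (s *_) xs) ≡ s ^ D * evalTerm t xs
evalTerm-scale s {D = D} (term c es) deg≡D xs with c ℤ.≟ + 0
... | yes refl = sym (*-zeroʳ (s ^ D))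
... | no  c≢0  = begin
  c * monomial es (Vec.map (s *_) xs) ≡⟨ cong (c *_) (monomial-scale s es xs) ⟩
  c * (s ^ Vec.sum es * M)            ≡⟨ cong (λ e → c * (s ^ e * M)) (deg≡D c≢0) ⟩
  c * (s ^ D * M)                     ≡⟨ swap c (s ^ D) M ⟩
  s ^ D * (c * M)                     ∎
  where
  open ≡-Reasoning
  M : ℤ
  M = monomial es xs
  swap : ∀ a b c → a * (b * c) ≡ b * (a * c)
  swap = ℤ-Ring.solve-∀

eval-scale : ∀ s {k} (f : Poly k) (hom : Homogeneous f) xs →
             eval f (Vec.map (s *_) xs) ≡ s ^ proj₁ hom * eval f xs
eval-scale s []      (D , [])              xs = sym (*-zeroʳ (s ^ D))
eval-scale s (t ∷ f) (D , deg≡D ∷ degs≡D) xs = begin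
  evalTerm t (Vec.map (s *_) xs) + eval f (Vec.map (s *_) xs)
    ≡⟨ cong₂ _+_ (evalTerm-scale s t deg≡D xs) (eval-scale s f (D , degs≡D) xs) ⟩
  s ^ D * evalTerm t xs + s ^ D * eval f xs
    ≡⟨ *-distribˡ-+ (s ^ D) (evalTerm t xs) (eval f xs) ⟨
  s ^ D * (evalTerm t xs + eval f xs)
    ∎
  where open ≡-Reasoning

linForm-scale : ∀ s {k} (as xs : Vec ℤ k) → linForm as (Vec.map (s *_) xs) ≡ s * linForm as xs
linForm-scale s []       []       = sym (*-zeroʳ s)
linForm-scale s (a ∷ as) (x ∷ xs) = begin
  a * (s * x) + linForm as (Vec.map (s *_) xs) ≡⟨ cong (λ l → a * (s * x) + l) (linForm-scale s as xs) ⟩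
  a * (s * x) + s * linForm as xs              ≡⟨ factor a s x (linForm as xs) ⟩
  s * (a * x + linForm as xs)                  ∎
  where
  open ≡-Reasoning
  factor : ∀ a s x l → a * (s * x) + s * l ≡ s * (a * x + l)
  factor = ℤ-Ring.solve-∀

-- Congruences modulo n

gcd[i,j]∣gcd[k*i,j] : ∀ k i j → gcd i j ∣ gcd (k * i) j
gcd[i,j]∣gcd[k*i,j] k i j = gcd-greatest {k * i} {j} {gcd i j}
  (ℕ.∣-trans (gcd[i,j]∣i i j) (∣⇒∣ᵤ (∣n⇒∣m*n k (Signed.∣-refl {i})))) (gcd[i,j]∣j i j)

module Modulo (n : ℕ) where

  -- A record, unlike _≡_[mod_], so that unification can recover x and y from x ≈ y.
  infix 4 _≈_
  record _≈_ (x y : ℤ) : Set where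
    constructor mk≈
    field
      ≈⇒∣ : + n Signed.∣ x - y
  open _≈_ public

  ≡[mod]⇒≈ : ∀ {x y} → x ≡ y [mod n ] → x ≈ y
  ≡[mod]⇒≈ x≡y = mk≈ (∣ᵤ⇒∣ x≡y)

  ≈⇒≡[mod] : ∀ {x y} → x ≈ y → x ≡ y [mod n ]
  ≈⇒≡[mod] x≈y = ∣⇒∣ᵤ (≈⇒∣ x≈y)

  private
    ≈-by : ∀ {x y e} → x - y ≡ e → + n Signed.∣ e → x ≈ y
    ≈-by x-y≡e n∣e = mk≈ (subst (+ n Signed.∣_) (sym x-y≡e) n∣e)

  x+q*n≈x : ∀ x q → x + q * + n ≈ x
  x+q*n≈x x q = ≈-by (difference x (q * + n)) (divides q refl)
    where
    difference : ∀ x y → x + y - x ≡ y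
    difference = ℤ-Ring.solve-∀

  ≈-refl : Reflexive _≈_
  ≈-refl {x} = ≈-by (+-inverseʳ x) (divides (+ 0) (sym (*-zeroˡ (+ n))))

  ≈-sym : Symmetric _≈_
  ≈-sym {x} {y} x≈y = ≈-by (swap x y) (∣m⇒∣-m (≈⇒∣ x≈y))
    where
    swap : ∀ x y → y - x ≡ - (x - y)
    swap = ℤ-Ring.solve-∀

  ≈-trans : Transitive _≈_
  ≈-trans {x} {y} {z} x≈y y≈z = ≈-by (split x y z) (∣m∣n⇒∣m+n (≈⇒∣ x≈y) (≈⇒∣ y≈z))
    where
    split : ∀ x y z → x - z ≡ (x - y) + (y - z)
    split = ℤ-Ring.solve-∀

  ≈-reflexive : ∀ {x y} → x ≡ y → x ≈ y
  ≈-reflexive refl = ≈-refl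

  ≈-isEquivalence : IsEquivalence _≈_
  ≈-isEquivalence = record { refl = ≈-refl ; sym = ≈-sym ; trans = ≈-trans }

  ≈-setoid : Setoid 0ℓ 0ℓ
  ≈-setoid = record { isEquivalence = ≈-isEquivalence }

  +-cong : ∀ {x y u v} → x ≈ y → u ≈ v → x + u ≈ y + v
  +-cong {x} {y} {u} {v} x≈y u≈v = ≈-by (split x y u v) (∣m∣n⇒∣m+n (≈⇒∣ x≈y) (≈⇒∣ u≈v))
    where
    split : ∀ x y u v → x + u - (y + v) ≡ (x - y) + (u - v)
    split = ℤ-Ring.solve-∀

  *-cong : ∀ {x y u v} → x ≈ y → u ≈ v → x * u ≈ y * v
  *-cong {x} {y} {u} {v} x≈y u≈v =
    ≈-by (split x y u v) (∣m∣n⇒∣m+n (∣m⇒∣m*n u (≈⇒∣ x≈y)) (∣n⇒∣m*n y (≈⇒∣ u≈v)))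
    where
    split : ∀ x y u v → x * u - y * v ≡ (x - y) * u + y * (u - v)
    split = ℤ-Ring.solve-∀

  -‿cong : ∀ {x y} → x ≈ y → - x ≈ - y
  -‿cong {x} {y} x≈y = ≈-by (negate x y) (∣m⇒∣-m (≈⇒∣ x≈y))
    where
    negate : ∀ x y → - x - - y ≡ - (x - y)
    negate = ℤ-Ring.solve-∀

  ^-cong : ∀ {x y} e → x ≈ y → x ^ e ≈ y ^ e
  ^-cong zero    x≈y = ≈-refl
  ^-cong (suc e) x≈y = *-cong x≈y (^-cong e x≈y)

  monomial-cong : ∀ {k} (es : Vec ℕ k) {xs ys} → Pointwise _≈_ xs ys → monomial es xs ≈ monomial es ys
  monomial-cong []       []            = ≈-refl
  monomial-cong (e ∷ es) (x≈y ∷ xs≈ys) = *-cong (^-cong e x≈y) (monomial-cong es xs≈ys)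

  eval-cong : ∀ {k} (f : Poly k) {xs ys} → Pointwise _≈_ xs ys → eval f xs ≈ eval f ys
  eval-cong []              xs≈ys = ≈-refl
  eval-cong (term c es ∷ f) xs≈ys =
    +-cong (*-cong (≈-refl {c}) (monomial-cong es xs≈ys)) (eval-cong f xs≈ys)

  linForm-cong : ∀ {k} (as : Vec ℤ k) {xs ys} → Pointwise _≈_ xs ys → linForm as xs ≈ linForm as ys
  linForm-cong []       []            = ≈-refl
  linForm-cong (a ∷ as) (x≈y ∷ xs≈ys) = +-cong (*-cong (≈-refl {a}) x≈y) (linForm-cong as xs≈ys)

  residue-unique : ∀ {x y} → x < n → y < n → + x ≈ + y → x ≡ y
  residue-unique {x} {y} x<n y<n x≈y =
    +-injective (i-j≡0⇒i≡j (+ x) (+ y) (∣i∣≡0⇒i≡0 (multiple<n⇒0 distance<n (≈⇒≡[mod] x≈y))))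
    where
    distance<n : ∣ + x - + y ∣ < n
    distance<n = subst (_< n) (cong ∣_∣ (sym ([+m]-[+n]≡m⊖n x y)))
                       (ℕ.≤-<-trans (∣m⊝n∣≤m⊔n x y) (ℕ.⊔-pres-<m x<n y<n))
    multiple<n⇒0 : ∀ {m} → m < n → n ℕ.∣ m → m ≡ 0
    multiple<n⇒0 {zero}  _   _   = refl
    multiple<n⇒0 {suc m} m<n n∣m = contradiction n∣m (ℕ.>⇒∤ m<n)

  residue≈ : ∀ x .{{_ : NonZero n}} → + (x %ℕ n) ≈ x
  residue≈ x = ≈-sym (≈-trans (≈-reflexive (a≡a%ℕn+[a/ℕn]*n x n)) (x+q*n≈x _ (x /ℕ n)))

  ∣-respʳ-≈ : ∀ {d x y} → d ∣ + n → d ∣ x → x ≈ y → d ∣ y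
  ∣-respʳ-≈ {d} {x} {y} d∣n d∣x x≈y = ∣⇒∣ᵤ (subst (d Signed.∣_) (cancel x y)
    (∣m∣n⇒∣m-n {d} {x} {x - y} (∣ᵤ⇒∣ d∣x) (Signed.∣-trans (∣ᵤ⇒∣ d∣n) (≈⇒∣ x≈y))))
    where
    cancel : ∀ x y → x - (x - y) ≡ y
    cancel = ℤ-Ring.solve-∀

  gcd-cong : ∀ {x y} → x ≈ y → gcd x (+ n) ≡ gcd y (+ n)
  gcd-cong {x} {y} x≈y =
    cong +_ (ℕ.∣-antisym (gcd-divides {x} {y} x≈y) (gcd-divides {y} {x} (≈-sym x≈y)))
    where
    gcd-divides : ∀ {x y} → x ≈ y → gcd x (+ n) ∣ gcd y (+ n)
    gcd-divides {x} {y} x≈y = gcd-greatest {y} {+ n} {gcd x (+ n)}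
      (∣-respʳ-≈ {gcd x (+ n)} {x} {y} (gcd[i,j]∣j x (+ n)) (gcd[i,j]∣i x (+ n)) x≈y) (gcd[i,j]∣j x (+ n))

  Invertible : ℤ → Set
  Invertible s = ∃ λ s′ → s′ * s ≈ + 1

  inverse-cancel : ∀ {s s′} → s′ * s ≈ + 1 → ∀ x → s′ * (s * x) ≈ x
  inverse-cancel {s} {s′} s′s≈1 x = begin
    s′ * (s * x) ≡⟨ *-assoc s′ s x ⟨
    s′ * s * x   ≈⟨ *-cong s′s≈1 (≈-refl {x}) ⟩
    + 1 * x      ≡⟨ *-identityˡ x ⟩
    x            ∎
    where open ≈-Reasoning ≈-setoid

  *-cancelˡ-invertible : ∀ {s x y} → Invertible s → s * x ≈ s * y → x ≈ y
  *-cancelˡ-invertible {s} {x} {y} (s′ , s′s≈1) sx≈sy = begin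
    x            ≈⟨ inverse-cancel {s} {s′} s′s≈1 x ⟨
    s′ * (s * x) ≈⟨ *-cong (≈-refl {s′}) sx≈sy ⟩
    s′ * (s * y) ≈⟨ inverse-cancel {s} {s′} s′s≈1 y ⟩
    y            ∎
    where open ≈-Reasoning ≈-setoid

  -‿invertible : ∀ {s} → Invertible s → Invertible (- s)
  -‿invertible {s} (s′ , s′s≈1) = - s′ , ≈-trans (≈-reflexive (neg-neg s′ s)) s′s≈1
    where
    neg-neg : ∀ a b → - a * - b ≡ a * b
    neg-neg = ℤ-Ring.solve-∀

  ^-invertible : ∀ {s} e → Invertible s → Invertible (s ^ e)
  ^-invertible {s} e (s′ , s′s≈1) = s′ ^ e , (begin
    s′ ^ e * s ^ e ≡⟨ ^-distrib-* s′ s e ⟨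
    (s′ * s) ^ e   ≈⟨ ^-cong e s′s≈1 ⟩
    (+ 1) ^ e      ≡⟨ ^-zeroˡ e ⟩
    + 1            ∎)
    where open ≈-Reasoning ≈-setoid

  gcd-*-invertible : ∀ {s} x → Invertible s → gcd (s * x) (+ n) ≡ gcd x (+ n)
  gcd-*-invertible {s} x (s′ , s′s≈1) =
    cong +_ (ℕ.∣-antisym gcd[sx,n]∣gcd[x,n] (gcd[i,j]∣gcd[k*i,j] s x (+ n)))
    where
    gcd[sx,n]∣gcd[x,n] : gcd (s * x) (+ n) ∣ gcd x (+ n)
    gcd[sx,n]∣gcd[x,n] = subst (gcd (s * x) (+ n) ∣_) (gcd-cong (inverse-cancel {s} {s′} s′s≈1 x))
                               (gcd[i,j]∣gcd[k*i,j] s′ (s * x) (+ n))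

pos-+-* : ∀ a q n → + (a ℕ.+ q ℕ.* n) ≡ + a + + q * + n
pos-+-* a q n = trans (pos-+ a (q ℕ.* n)) (cong (λ z → + a + z) (pos-* q n))

coprime⇒invertible : ∀ {t n} → Coprime t n → Modulo.Invertible n (+ t)
coprime⇒invertible {t} {n} t⊥n with coprime-Bézout t⊥n
... | Bézout.+- x y 1+yn≡xt = + x , (begin
  + x * + t         ≡⟨ pos-* x t ⟨
  + (x ℕ.* t)       ≡⟨ cong +_ 1+yn≡xt ⟨
  + (1 ℕ.+ y ℕ.* n) ≡⟨ pos-+-* 1 y n ⟩
  + 1 + + y * + n   ≈⟨ x+q*n≈x (+ 1) (+ y) ⟩
  + 1               ∎)
  where open Modulo n; open ≈-Reasoning ≈-setoid
... | Bézout.-+ x y 1+xt≡yn = - + x , (begin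
  - + x * + t             ≡⟨ negate (+ x) (+ t) ⟩
  + 1 - (+ 1 + + x * + t) ≡⟨ cong (λ z → + 1 - z) 1+xt≡yn′ ⟩
  + 1 - + y * + n         ≡⟨ negate′ (+ 1) (+ y) (+ n) ⟩
  + 1 + - + y * + n       ≈⟨ x+q*n≈x (+ 1) (- + y) ⟩
  + 1                     ∎)
  where
  open Modulo n
  open ≈-Reasoning ≈-setoid
  1+xt≡yn′ : + 1 + + x * + t ≡ + y * + n
  1+xt≡yn′ = trans (sym (pos-+-* 1 x t)) (trans (cong +_ 1+xt≡yn) (pos-* y n))
  negate : ∀ a b → - a * b ≡ + 1 - (+ 1 + a * b)
  negate = ℤ-Ring.solve-∀
  negate′ : ∀ a b c → a - b * c ≡ a + - b * c
  negate′ = ℤ-Ring.solve-∀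

≡+multiple⇒≈ : ∀ {n B t j d} → t ℕ.* d ≡ B ℕ.+ j ℕ.* n → Modulo._≈_ n (+ B) (+ t * + d)
≡+multiple⇒≈ {n} {B} {t} {j} {d} t*d≡B+j*n = begin
  + B               ≈⟨ x+q*n≈x (+ B) (+ j) ⟨
  + B + + j * + n   ≡⟨ pos-+-* B j n ⟨
  + (B ℕ.+ j ℕ.* n) ≡⟨ cong +_ t*d≡B+j*n ⟨
  + (t ℕ.* d)       ≡⟨ pos-* t d ⟩
  + t * + d         ∎
  where open Modulo n; open ≈-Reasoning ≈-setoid

-- Lets and explicit implicits rather than with-abstraction: the latter makes Agda unfold ℕ.gcd, very slowly.
gcd-associateℕ : ∀ B n .{{_ : NonZero n}} →
                 ∃ λ t → Modulo.Invertible n (+ t) × Modulo._≈_ n (+ B) (+ t * + ℕ.gcd B n)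
gcd-associateℕ B n =
  let t , j , t⊥n , t*d≡B+j*n = unit-multiple-of-gcd B n
  in  t , coprime⇒invertible t⊥n , ≡+multiple⇒≈ {n} {B} {t} {j} {ℕ.gcd B n} t*d≡B+j*n

gcd-associate : ∀ b n .{{_ : NonZero n}} →
                ∃ λ s → Modulo.Invertible n s × Modulo._≈_ n b (s * gcd b (+ n))
gcd-associate (+ B)    n = let t , t-invertible , B≈t*d = gcd-associateℕ B n in + t , t-invertible , B≈t*d
gcd-associate -[1+ B ] n =
  let t , t-invertible , B≈t*d = gcd-associateℕ (suc B) n
  in  - + t , -‿invertible t-invertible
      , ≈-trans (-‿cong B≈t*d) (≈-reflexive (neg-distribˡ-* (+ t) (+ ℕ.gcd (suc B) n)))
  where open Modulo n

-- Multiplication by a unit on (ℤ_n)^k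

module Scaling (n : ℕ) .{{_ : NonZero n}} where
  open Modulo n

  scale : ℤ → Fin n → Fin n
  scale s i = fromℕ< (n%ℕd<d (s * + toℕ i) n)

  residue-scale : ∀ s i → + toℕ (scale s i) ≈ s * + toℕ i
  residue-scale s i = ≈-trans (≈-reflexive (cong +_ (toℕ-fromℕ< _))) (residue≈ (s * + toℕ i))

  lift-map-scale : ∀ s {k} (x : Vec (Fin n) k) →
                   Pointwise _≈_ (lift (Vec.map (scale s) x)) (Vec.map (s *_) (lift x))
  lift-map-scale s []      = []
  lift-map-scale s (i ∷ x) = residue-scale s i ∷ lift-map-scale s x

  scale-inverse : ∀ s s′ → s′ * s ≈ + 1 → ∀ i → scale s′ (scale s i) ≡ i
  scale-inverse s s′ s′s≈1 i = toℕ-injective (residue-unique (toℕ<n _) (toℕ<n i) (begin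
    + toℕ (scale s′ (scale s i)) ≈⟨ residue-scale s′ (scale s i) ⟩
    s′ * + toℕ (scale s i)       ≈⟨ *-cong (≈-refl {s′}) (residue-scale s i) ⟩
    s′ * (s * + toℕ i)           ≈⟨ inverse-cancel {s} {s′} s′s≈1 (+ toℕ i) ⟩
    + toℕ i                      ∎))
    where open ≈-Reasoning ≈-setoid

  scale-permutation : ∀ {s} → Invertible s → Permutation′ n
  scale-permutation {s} (s′ , s′s≈1) = permutation (scale s) (scale s′)
    (scale-inverse s′ s (≈-trans (≈-reflexive (*-comm s s′)) s′s≈1)) (scale-inverse s s′ s′s≈1)

  linForm-lift-scale : ∀ s {k} (as : Vec ℤ k) x →
                       linForm as (lift (Vec.map (scale s) x)) ≈ s * linForm as (lift x)
  linForm-lift-scale s as x =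
    ≈-trans (linForm-cong as (lift-map-scale s x)) (≈-reflexive (linForm-scale s as (lift x)))

  gcd-eval-lift-scale : ∀ {s} → Invertible s → ∀ {k} (f : Poly k) → Homogeneous f → ∀ x →
                        gcd (eval f (lift (Vec.map (scale s) x))) (+ n) ≡ gcd (eval f (lift x)) (+ n)
  gcd-eval-lift-scale {s} s-invertible f hom x = begin
    gcd (eval f (lift (Vec.map (scale s) x))) (+ n)
      ≡⟨ gcd-cong (eval-cong f (lift-map-scale s x)) ⟩
    gcd (eval f (Vec.map (s *_) (lift x))) (+ n)
      ≡⟨ cong (λ v → gcd v (+ n)) (eval-scale s f hom (lift x)) ⟩
    gcd (s ^ proj₁ hom * eval f (lift x)) (+ n)
      ≡⟨ gcd-*-invertible (eval f (lift x)) (^-invertible (proj₁ hom) s-invertible) ⟩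
    gcd (eval f (lift x)) (+ n)
      ∎
    where open ≡-Reasoning

  good-scale : ∀ {k m} {F : Vec (Poly k) m} → All Homogeneous F →
               ∀ a {b c s} → Invertible s → b ≈ s * c →
               (Good F a b n ∘ Vec.map (scale s)) ≐ Good F a c n
  good-scale {F = F} homs a {b} {c} {s} s-invertible b≈sc = forward , backward
    where
    open ≈-Reasoning ≈-setoid
    forward : (Good F a b n ∘ Vec.map (scale s)) ⊆ Good F a c n
    forward {x} (ax≡b , coprime) = ≈⇒≡[mod] (*-cancelˡ-invertible s-invertible (begin
        s * linForm a (lift x)                 ≈⟨ linForm-lift-scale s a x ⟨
        linForm a (lift (Vec.map (scale s) x)) ≈⟨ ≡[mod]⇒≈ ax≡b ⟩
        b                                      ≈⟨ b≈sc ⟩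
        s * c                                  ∎))
      , VecAll.map (λ {f} (hom , coprime-f) → trans (sym (gcd-eval-lift-scale s-invertible f hom x))
                                                     coprime-f)
                   (VecAll.zip (homs , coprime))
    backward : Good F a c n ⊆ (Good F a b n ∘ Vec.map (scale s))
    backward {x} (ax≡c , coprime) = ≈⇒≡[mod] (begin
        linForm a (lift (Vec.map (scale s) x)) ≈⟨ linForm-lift-scale s a x ⟩
        s * linForm a (lift x)                 ≈⟨ *-cong (≈-refl {s}) (≡[mod]⇒≈ ax≡c) ⟩
        s * c                                  ≈⟨ b≈sc ⟨
        b                                      ∎)
      , VecAll.map (λ {f} (hom , coprime-f) → trans (gcd-eval-lift-scale s-invertible f hom x) coprime-f)
                   (VecAll.zip (homs , coprime))

  g-associate : ∀ {k m} {F : Vec (Poly k) m} → All Homogeneous F →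
                ∀ a {b c s} → Invertible s → b ≈ s * c →
                g F a b n ≡ g F a c n
  g-associate {k} {F = F} homs a {b} {c} s-invertible b≈sc = begin
    length (filter (good? F a b n) (allVecs k n))
      ≡⟨ length-filter-allVecs-permute π k (good? F a b n) ⟩
    length (filter (good? F a b n ∘ Vec.map (π ⟨$⟩ʳ_)) (allVecs k n))
      ≡⟨ cong length (filter-≐ _ (good? F a c n) good≐good (allVecs k n)) ⟩
    length (filter (good? F a c n) (allVecs k n))
      ∎
    where
    open ≡-Reasoning
    π : Permutation′ n
    π = scale-permutation s-invertible
    good≐good : (Good F a b n ∘ Vec.map (π ⟨$⟩ʳ_)) ≐ Good F a c n
    good≐good = good-scale homs a s-invertible b≈sc

mainTheorem11 : (k m : ℕ) (F : Vec (Poly k) m) → All Homogeneous F → (a : Vec ℤ k) (n : ℕ) → n ≥ 1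
    → (b : ℤ) → g F a b n ≡ g F a (gcd b (+ n)) n
mainTheorem11 k m F homs a n n≥1 b =
  let _ , s-invertible , b≈s*gcd = gcd-associate b n
  in  Scaling.g-associate n homs a s-invertible b≈s*gcd
  where
  instance
    n≢0 : NonZero n
    n≢0 = ℕ.>-nonZero n≥1
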